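{- Let $k\ge2$, $m\ge1$ be integers, $b\in\mathbb{Z}$ with $\gcd(b,m)=1$, and $Q\ge1$ an integer. Let $f$ be any complex-valued function on $[0,1]$ and write $\mathscr{F}_{Q,k}^{(m)}=\{\gamma_1,\dots,\gamma_{\mathcal{N}(Q,k,m)}\}$. Then \[\sum_{j=1}^{\mathcal{N}(Q,k,m)}f(\gamma_j)=\sum_{q\le Q}M_q\!\left(\frac{Q}{q}\right)\sum_{a\le q}f\!\left(\frac aq\right),\qquad M_q(x)=\sum_{\substack{n\le x\\ qn\equiv b\ (\mathrm{mod}\ m)}}\mu(n)\mu_k(qn)^2,\] where $a$ and $q$ range over positive integers.
   Context: $\mu$ is the Möbius function and $\mu_k(n)^2$ is the indicator of $k$-free positive integers ($n$ is $k$-free if $p^k\nmid n$ for every prime $p$). $\mathscr{F}_{Q,k}^{(m)}=\{a/q : 1\le a\le q\le Q,\ \gcd(a,q)=1,\ q \text{ } k\text{ -free},\ q\equiv b\ (\mathrm{mod}\ m)\}$ and $\mathcal{N}(Q,k,m)$ is its cardinality. -}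

module Defs where

open import Level using (Level)
open import Data.Bool using (Bool; true; false; if_then_else_)
open import Data.Nat as ℕ using (ℕ; zero; suc; _^_; _≤_; _≤?_)
open import Data.Nat.Divisibility using (_∣_; _∣?_)
open import Data.Nat.Primality using (Prime; prime?)
open import Data.Integer as ℤ using (ℤ; +_; -[1+_]; 1ℤ; 0ℤ)
import Data.Integer.Divisibility as ℤD
open import Data.List using (List; []; _∷_; filter; length; upTo; map; foldr)
open import Relation.Nullary using (¬_; Dec; yes; no; does)
open import Relation.Nullary.Decidable using (_×-dec_; ¬?)
open import Algebra.Bundles using (CommutativeRing)

allB : {A : Set} → (A → Bool) → List A → Bool
allB P []       = true
allB P (x ∷ xs) = if P x then allB P xs else false

_≡_[mod_] : ℤ → ℤ → ℕ → Set
x ≡ y [mod m ] = (+ m) ℤD.∣ (x ℤ.- y)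

KFree : ℕ → ℕ → Set
KFree k n = ∀ p → Prime p → ¬ (p ^ k ∣ n)

primesUpTo : ℕ → List ℕ
primesUpTo n = filter prime? (upTo (suc n))

-- Indicator μ_k(n)^2 of k-free positive integers n.
-- For n ≥ 1, p^k ∣ n with k ≥ 1 forces p ≤ n, so checking primes p ≤ n suffices.
μk² : ℕ → ℕ → ℤ
μk² k n = if allB (λ p → does (¬? (p ^ k ∣? n))) (primesUpTo n) then 1ℤ else 0ℤ

ω : ℕ → ℕ
ω n = length (filter (λ p → p ∣? n) (primesUpTo n))

μ : ℕ → ℤ
μ n = if allB (λ p → does (¬? (p ^ 2 ∣? n))) (primesUpTo n)
      then (ℤ.- 1ℤ) ℤ.^ ω n
      else 0ℤ

sumℤ : ℕ → (ℕ → ℤ) → ℤ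
sumℤ zero    f = 0ℤ
sumℤ (suc N) f = sumℤ N f ℤ.+ f (suc N)

module _ {c ℓ : Level} (R : CommutativeRing c ℓ) where
  open CommutativeRing R

  -- Σ_{i=1}^{N} f i  in R, where the summand receives the PREDECESSOR i' of i
  -- (i = suc i'), so that i is visibly nonzero (needed for division a/i in ℚ).
  sumR : ℕ → (ℕ → Carrier) → Carrier
  sumR zero    g = 0#
  sumR (suc N) g = sumR N g + g N

  sumList : List Carrier → Carrier
  sumList = foldr _+_ 0#

  ιℕ : ℕ → Carrier
  ιℕ zero    = 0#
  ιℕ (suc n) = ιℕ n + 1#

  ι : ℤ → Carrier
  ι (+ n)      = ιℕ n
  ι -[1+ n ]   = - ιℕ (suc n)

-- M_q(Q/q) = Σ_{n ≤ ⌊Q/q⌋, qn ≡ b (mod m)} μ(n) μ_k(qn)^2, n ≥ 1.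
-- Here q = suc q' (so the division is defined).
M : (k m : ℕ) (b : ℤ) (Q q' : ℕ) → ℤ
M k m b Q q' = sumℤ (Q ℕ./ suc q') (λ n →
  if does (m ∣? ℤ.∣ (+ (suc q' ℕ.* n)) ℤ.- b ∣)
  then μ n ℤ.* μk² k (suc q' ℕ.* n)
  else 0ℤ)

{-# OPTIONS --safe #-}
-- Listing the fractions row by row turns the left-hand side into
-- Σ_{q ≤ Q} Σ_{a ≤ q} [gcd(a,q) = 1] t(q) f(a/q), where t(q) = [q ≡ b (mod m)] μ_k(q)²
-- (admissible q).
-- Möbius inversion, [gcd(a,q) = 1] = Σ_{d ∣ a, d ∣ q} μ(d), followed by the substitution
-- a = d a₁, q = d q₁ and f(d a₁ / d q₁) = f(a₁/q₁), rewrites this as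
-- Σ_{q₁ ≤ Q} (Σ_{d ≤ Q/q₁} μ(d) t(q₁ d)) Σ_{a₁ ≤ q₁} f(a₁/q₁), and the sum over d is M_{q₁}(Q/q₁).
module Submission where

open import Defs
open import Level using (Level)
open import Data.Bool using (Bool; true; false; if_then_else_; _∧_; not)
open import Data.Bool.Properties using (T-≡)
open import Data.Nat as ℕ using (ℕ; zero; suc; _^_; _≤_; _<_; _≤?_; _≟_; z≤n; s≤s)
import Data.Nat.Properties as ℕ
open import Data.Nat.Divisibility
open import Data.Nat.DivMod using (m/n*n≤m; m/n≤m; /-monoˡ-≤; m*n/n≡m)
open import Data.Nat.Coprimality using (Coprime; coprime?; coprime-divisor; coprime⇒gcd≡1; gcd≡1⇒coprime)
open import Data.Nat.GCD using (gcd; gcd[m,n]∣m; gcd[m,n]∣n; gcd-greatest; gcd[m,n]≤n; gcd[m,n]≢0)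
open import Data.Nat.Primality using (Prime; prime?; prime[2]; euclidsLemma; prime⇒irreducible; ¬prime[1]; prime⇒nonZero)
open import Data.Nat.Primality.Factorisation using (factorise; PrimeFactorisation)
open import Data.Nat.ListAction using (product)
open import Data.Integer as ℤ using (ℤ; +_; -[1+_]; 1ℤ; 0ℤ; _⊖_)
import Data.Integer.Properties as ℤ
open import Data.Integer.GCD as ℤG using ()
open import Data.Rational as ℚ using (ℚ; _/_; 0ℚ; ↥_; ↧ₙ_)
import Data.Rational.Properties as ℚ
open import Data.Rational.Unnormalised using (*≡*; mkℚᵘ)
open import Data.Product using (Σ; ∃-syntax; _×_; _,_; proj₁; proj₂)
open import Data.Sum using (_⊎_; inj₁; inj₂)
open import Data.List using (List; []; _∷_; _++_; [_]; map; filter)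
open import Data.List.Properties using (map-++)
open import Data.List.Membership.Propositional using (_∈_)
open import Data.List.Membership.Propositional.Properties using (∈-++⁺ˡ; ∈-++⁺ʳ; ∈-++⁻; ∈-filter⁺; ∈-filter⁻; ∈-upTo⁺; ∈-upTo⁻)
open import Data.List.Membership.Propositional.Properties.WithK using (unique∧set⇒bag)
open import Data.List.Relation.Unary.Any using (here; there)
open import Data.List.Relation.Unary.All as All using (All)
open import Data.List.Relation.Unary.AllPairs using ([]; _∷_)
open import Data.List.Relation.Unary.Unique.Propositional using (Unique)
import Data.List.Relation.Unary.Unique.Propositional.Properties as Unique
open import Data.List.Relation.Binary.BagAndSetEquality using (∼bag⇒↭)
open import Data.List.Relation.Binary.Permutation.Propositional using (_↭_; ↭⇒↭ₛ′)
open import Data.List.Relation.Binary.Permutation.Propositional.Properties using (↭-length; map⁺)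
open import Function.Base using (_∘_)
open import Function.Bundles using (_⇔_; mk⇔; Equivalence)
open import Function.Construct.Composition using (_⇔-∘_)
open import Function.Construct.Symmetry using (⇔-sym)
open import Relation.Nullary using (¬_; Dec; yes; no; does)
open import Relation.Nullary.Decidable using (¬?; _×-dec_; T?; map′; dec-true; dec-false; does-⇔)
open import Relation.Nullary.Negation using (contradiction)
open import Relation.Binary.PropositionalEquality using (_≡_; refl; sym; trans; cong; subst; subst₂; module ≡-Reasoning)
open import Algebra.Bundles using (CommutativeRing)

does≡true⇒ : ∀ {a} {A : Set a} (a? : Dec A) → does a? ≡ true → A
does≡true⇒ (yes a) _ = a

module _ {a} {A : Set a} where

  concatUpTo : ℕ → (ℕ → List A) → List A
  concatUpTo zero    L = []
  concatUpTo (suc n) L = concatUpTo n L ++ L (suc n)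

  ∈-concatUpTo⁻ : ∀ n L {x} → x ∈ concatUpTo n L → ∃[ i ] (1 ≤ i × i ≤ n × x ∈ L i)
  ∈-concatUpTo⁻ (suc n) L x∈ with ∈-++⁻ (concatUpTo n L) x∈
  ... | inj₂ x∈Lₙ = suc n , s≤s z≤n , ℕ.≤-refl , x∈Lₙ
  ... | inj₁ x∈ₙ  with ∈-concatUpTo⁻ n L x∈ₙ
  ...   | i , 1≤i , i≤n , x∈Lᵢ = i , 1≤i , ℕ.m≤n⇒m≤1+n i≤n , x∈Lᵢ

  ∈-concatUpTo⁺ : ∀ n L {x i} → 1 ≤ i → i ≤ n → x ∈ L i → x ∈ concatUpTo n L
  ∈-concatUpTo⁺ zero    L 1≤i i≤0 _ = contradiction (ℕ.≤-trans 1≤i i≤0) λ ()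
  ∈-concatUpTo⁺ (suc n) L 1≤i i≤1+n x∈Lᵢ with ℕ.m≤n⇒m<n∨m≡n i≤1+n
  ... | inj₁ (s≤s i≤n) = ∈-++⁺ˡ (∈-concatUpTo⁺ n L 1≤i i≤n x∈Lᵢ)
  ... | inj₂ refl      = ∈-++⁺ʳ (concatUpTo n L) x∈Lᵢ

  concatUpTo-unique : ∀ n L → (∀ i → Unique (L i)) →
                      (∀ {i j x} → x ∈ L i → x ∈ L j → i ≡ j) → Unique (concatUpTo n L)
  concatUpTo-unique zero    L uniq disj = []
  concatUpTo-unique (suc n) L uniq disj =
    Unique.++⁺ (concatUpTo-unique n L uniq disj) (uniq (suc n)) earlier≢last
    where
    earlier≢last : ∀ {x} → ¬ (x ∈ concatUpTo n L × x ∈ L (suc n))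
    earlier≢last (x∈ₙ , x∈Lₙ) with ∈-concatUpTo⁻ n L x∈ₙ
    ... | i , _ , i≤n , x∈Lᵢ = ℕ.<⇒≢ (s≤s i≤n) (disj x∈Lᵢ x∈Lₙ)

  ∈-if-[]⁻ : ∀ b {x y : A} → y ∈ (if b then [ x ] else []) → b ≡ true × y ≡ x
  ∈-if-[]⁻ true (here y≡x) = refl , y≡x

  ∈-if-[]⁺ : ∀ {b} {x : A} → b ≡ true → x ∈ (if b then [ x ] else [])
  ∈-if-[]⁺ refl = here refl

  if-[]-unique : ∀ b (x : A) → Unique (if b then [ x ] else [])
  if-[]-unique true  x = All.[] ∷ []
  if-[]-unique false x = []

  unique-↭ : ∀ {xs ys : List A} → Unique xs → Unique ys → (∀ {x} → x ∈ xs ⇔ x ∈ ys) → xs ↭ ys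
  unique-↭ uxs uys same = ∼bag⇒↭ (unique∧set⇒bag uxs uys same)

module Arithmetic where

  open import Data.Nat using (_+_; _*_)
  open ≡-Reasoning

  frac : ℕ → ℕ → ℚ
  frac a zero    = 0ℚ
  frac a (suc q) = (+ a) / suc q

  frac-injective : ∀ {a a′ q q′} → 1 ≤ q → 1 ≤ q′ → Coprime a q → Coprime a′ q′ →
                   frac a q ≡ frac a′ q′ → a ≡ a′ × q ≡ q′
  frac-injective {q = suc q} {suc q′} _ _ c c′ eq =
    ℤ.+-injective (cong ↥_ eq′) , cong suc (ℕ.suc-injective (cong ↧ₙ_ eq′))
    where eq′ = trans (sym (ℚ.normalize-coprime c)) (trans eq (ℚ.normalize-coprime c′))

  frac-*-cancel : ∀ d a q → 1 ≤ d → 1 ≤ q → frac (d * a) (d * q) ≡ frac a q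
  frac-*-cancel (suc d) a (suc q) _ _ = ℚ.fromℚᵘ-cong {mkℚᵘ (+ (suc d * a)) (q + d * suc q)} {mkℚᵘ (+ a) q}
                                          (*≡* cross-multiplied)
    where
    cross-multiplied : + (suc d * a) ℤ.* + suc q ≡ + a ℤ.* + (suc d * suc q)
    cross-multiplied = begin
      + (suc d * a) ℤ.* + suc q  ≡⟨ ℤ.pos-* (suc d * a) (suc q) ⟨
      + (suc d * a * suc q)      ≡⟨ cong (λ x → + (x * suc q)) (ℕ.*-comm (suc d) a) ⟩
      + (a * suc d * suc q)      ≡⟨ cong +_ (ℕ.*-assoc a (suc d) (suc q)) ⟩
      + (a * (suc d * suc q))    ≡⟨ ℤ.pos-* a (suc d * suc q) ⟩
      + a ℤ.* + (suc d * suc q)  ∎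

  prime⇒≥1 : ∀ {p} → Prime p → 1 ≤ p
  prime⇒≥1 p-prime = ℕ.>-nonZero⁻¹ _ ⦃ prime⇒nonZero p-prime ⦄

  prime∣prime⇒≡ : ∀ {r p} → Prime r → Prime p → r ∣ p → r ≡ p
  prime∣prime⇒≡ r-prime p-prime r∣p with prime⇒irreducible p-prime r∣p
  ... | inj₁ refl = contradiction r-prime ¬prime[1]
  ... | inj₂ r≡p  = r≡p

  prime∤⇒coprime : ∀ {p d} → Prime p → ¬ p ∣ d → Coprime d p
  prime∤⇒coprime p-prime p∤d (i∣d , i∣p) with prime⇒irreducible p-prime i∣p
  ... | inj₁ i≡1  = i≡1
  ... | inj₂ refl = contradiction i∣d p∤d

  ∃-prime-divisor : ∀ n → 2 ≤ n → ∃[ p ] (Prime p × p ∣ n)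
  ∃-prime-divisor n n≥2 = first-factor (factors pf) (isFactorisation pf) (factorsPrime pf)
    where
    open PrimeFactorisation
    pf = factorise n ⦃ ℕ.>-nonZero (ℕ.≤-trans (s≤s z≤n) n≥2) ⦄
    first-factor : ∀ ps → n ≡ product ps → All Prime ps → ∃[ p ] (Prime p × p ∣ n)
    first-factor []       n≡1 _                = contradiction (subst (2 ≤_) n≡1 n≥2) λ { (s≤s ()) }
    first-factor (p ∷ ps) n≡ (p-prime All.∷ _) = p , p-prime , subst (p ∣_) (sym n≡) (m∣m*n (product ps))

  ^-∣⇒∣ : ∀ p k {n} → 1 ≤ k → p ^ k ∣ n → p ∣ n
  ^-∣⇒∣ p (suc k) _ pᵏ∣n = ∣-trans (m∣m*n (p ^ k)) pᵏ∣n

  p²≡p*p : ∀ p → p ^ 2 ≡ p * p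
  p²≡p*p p = cong (p *_) (ℕ.*-identityʳ p)

  allB-sound : ∀ {A : Set} (P : A → Bool) xs → allB P xs ≡ true → ∀ {x} → x ∈ xs → P x ≡ true
  allB-sound P (y ∷ ys) all≡true x∈ with P y in Py≡
  allB-sound P (y ∷ ys) all≡true (here refl) | true = Py≡
  allB-sound P (y ∷ ys) all≡true (there x∈)  | true = allB-sound P ys all≡true x∈

  allB-complete : ∀ {A : Set} (P : A → Bool) xs → (∀ {x} → x ∈ xs → P x ≡ true) → allB P xs ≡ true
  allB-complete P []       _   = refl
  allB-complete P (y ∷ ys) all rewrite all (here refl) = allB-complete P ys (all ∘ there)

  ∈-primesUpTo⁻ : ∀ {n p} → p ∈ primesUpTo n → Prime p × p ≤ n
  ∈-primesUpTo⁻ p∈ with ∈-filter⁻ prime? p∈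
  ... | p∈upTo , p-prime = p-prime , ℕ.≤-pred (∈-upTo⁻ p∈upTo)

  ∈-primesUpTo⁺ : ∀ {n p} → Prime p → p ≤ n → p ∈ primesUpTo n
  ∈-primesUpTo⁺ p-prime p≤n = ∈-filter⁺ prime? (∈-upTo⁺ (s≤s p≤n)) p-prime

  -- The test by which Defs computes μk² k n, and μ n with k = 2.
  kFreeᵇ : ℕ → ℕ → Bool
  kFreeᵇ k n = allB (λ p → does (¬? (p ^ k ∣? n))) (primesUpTo n)

  kFreeᵇ-sound : ∀ {k n} → 1 ≤ k → 1 ≤ n → kFreeᵇ k n ≡ true → KFree k n
  kFreeᵇ-sound {k} {n} k≥1 n≥1 test p p-prime pᵏ∣n =
    does≡true⇒ (¬? (p ^ k ∣? n)) (allB-sound _ (primesUpTo n) test p∈) pᵏ∣n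
    where p∈ = ∈-primesUpTo⁺ p-prime (∣⇒≤ ⦃ ℕ.>-nonZero n≥1 ⦄ (^-∣⇒∣ p k k≥1 pᵏ∣n))

  kFreeᵇ-complete : ∀ {k n} → KFree k n → kFreeᵇ k n ≡ true
  kFreeᵇ-complete {k} {n} kfree = allB-complete _ (primesUpTo n) λ {p} p∈ →
    dec-true (¬? (p ^ k ∣? n)) (kfree p (proj₁ (∈-primesUpTo⁻ {n} p∈)))

  kFree? : ∀ {k} → 1 ≤ k → ∀ n → Dec (KFree k n)
  kFree? k≥1 zero        = no λ kfree → kfree 2 prime[2] (_ ∣0)
  kFree? {k} k≥1 (suc n) = map′ (kFreeᵇ-sound {k} k≥1 (s≤s z≤n) ∘ T-≡ .Equivalence.to)
                                (T-≡ .Equivalence.from ∘ kFreeᵇ-complete {k}) (T? (kFreeᵇ k (suc n)))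

  primeDivisors : ℕ → List ℕ
  primeDivisors n = filter (_∣? n) (primesUpTo n)

  ∈-primeDivisors⁻ : ∀ {n p} → p ∈ primeDivisors n → Prime p × p ∣ n
  ∈-primeDivisors⁻ {n} p∈ with ∈-filter⁻ (_∣? n) {xs = primesUpTo n} p∈
  ... | p∈primes , p∣n = proj₁ (∈-primesUpTo⁻ {n} p∈primes) , p∣n

  ∈-primeDivisors⁺ : ∀ {n p} → 1 ≤ n → Prime p → p ∣ n → p ∈ primeDivisors n
  ∈-primeDivisors⁺ {n} n≥1 p-prime p∣n =
    ∈-filter⁺ (_∣? n) (∈-primesUpTo⁺ p-prime (∣⇒≤ ⦃ ℕ.>-nonZero n≥1 ⦄ p∣n)) p∣n

  primeDivisors-unique : ∀ n → Unique (primeDivisors n)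
  primeDivisors-unique n = Unique.filter⁺ (_∣? n) (Unique.filter⁺ prime? (Unique.upTo⁺ (suc n)))

  primeDivisors-* : ∀ {p d} → Prime p → 1 ≤ d → ¬ p ∣ d → primeDivisors (p * d) ↭ p ∷ primeDivisors d
  primeDivisors-* {p} {d} p-prime d≥1 p∤d =
    unique-↭ (primeDivisors-unique (p * d)) (p∉ ∷ primeDivisors-unique d) (mk⇔ to from)
    where
    pd≥1 = ℕ.*-mono-≤ (prime⇒≥1 p-prime) d≥1
    p∉ : All (λ r → ¬ p ≡ r) (primeDivisors d)
    p∉ = All.tabulate λ r∈ p≡r → p∤d (subst (_∣ d) (sym p≡r) (proj₂ (∈-primeDivisors⁻ r∈)))
    to : ∀ {r} → r ∈ primeDivisors (p * d) → r ∈ p ∷ primeDivisors d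
    to r∈ with ∈-primeDivisors⁻ r∈
    ... | r-prime , r∣pd with euclidsLemma p d r-prime r∣pd
    ...   | inj₁ r∣p = here (prime∣prime⇒≡ r-prime p-prime r∣p)
    ...   | inj₂ r∣d = there (∈-primeDivisors⁺ d≥1 r-prime r∣d)
    from : ∀ {r} → r ∈ p ∷ primeDivisors d → r ∈ primeDivisors (p * d)
    from (here refl) = ∈-primeDivisors⁺ pd≥1 p-prime (m∣m*n d)
    from (there r∈) with ∈-primeDivisors⁻ r∈
    ... | r-prime , r∣d = ∈-primeDivisors⁺ pd≥1 r-prime (∣n⇒∣m*n p r∣d)

  ω-* : ∀ {p d} → Prime p → 1 ≤ d → ¬ p ∣ d → ω (p * d) ≡ suc (ω d)
  ω-* p-prime d≥1 p∤d = ↭-length (primeDivisors-* p-prime d≥1 p∤d)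

  KFree-*ʳ : ∀ {k} m {n} → KFree k (m * n) → KFree k n
  KFree-*ʳ m kfree r r-prime rᵏ∣n = kfree r r-prime (∣n⇒∣m*n m rᵏ∣n)

  ¬KFree2-*-dividing : ∀ {p d} → Prime p → p ∣ d → ¬ KFree 2 (p * d)
  ¬KFree2-*-dividing {p} {d} p-prime p∣d kfree =
    kfree p p-prime (subst (_∣ p * d) (sym (p²≡p*p p)) (*-monoʳ-∣ p p∣d))

  KFree2-*-nondividing : ∀ {p d} → Prime p → ¬ p ∣ d → KFree 2 d → KFree 2 (p * d)
  KFree2-*-nondividing {p} {d} p-prime p∤d kfree r r-prime r²∣pd
    with euclidsLemma p d r-prime (^-∣⇒∣ r 2 (s≤s z≤n) r²∣pd)
  ... | inj₁ r∣p with refl ← prime∣prime⇒≡ r-prime p-prime r∣p =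
    p∤d (*-cancelˡ-∣ p ⦃ prime⇒nonZero p-prime ⦄ (subst (_∣ p * d) (p²≡p*p p) r²∣pd))
  ... | inj₂ (divides s refl) with euclidsLemma p s r-prime r∣ps
    where
    instance _ = prime⇒nonZero r-prime
    r∣ps : r ∣ p * s
    r∣ps = *-cancelˡ-∣ r (subst₂ _∣_ (p²≡p*p r) (trans (sym (ℕ.*-assoc p s r)) (ℕ.*-comm (p * s) r)) r²∣pd)
  ... | inj₁ r∣p with refl ← prime∣prime⇒≡ r-prime p-prime r∣p = p∤d (n∣m*n s)
  ... | inj₂ r∣s = kfree r r-prime (subst (_∣ s * r) (sym (p²≡p*p r)) (*-monoˡ-∣ r r∣s))

  μ-squarefree : ∀ {n} → KFree 2 n → μ n ≡ (ℤ.- 1ℤ) ℤ.^ ω n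
  μ-squarefree {n} kfree = cong (λ b → if b then (ℤ.- 1ℤ) ℤ.^ ω n else 0ℤ) (kFreeᵇ-complete {2} kfree)

  μ-nonSquarefree : ∀ {n} → 1 ≤ n → ¬ KFree 2 n → μ n ≡ 0ℤ
  μ-nonSquarefree {n} n≥1 ¬kfree with kFreeᵇ 2 n in test
  ... | true  = contradiction (kFreeᵇ-sound {2} (s≤s z≤n) n≥1 test) ¬kfree
  ... | false = refl

  μ-*-dividing : ∀ {p d} → Prime p → 1 ≤ d → p ∣ d → μ (p * d) ≡ 0ℤ
  μ-*-dividing p-prime d≥1 p∣d =
    μ-nonSquarefree (ℕ.*-mono-≤ (prime⇒≥1 p-prime) d≥1) (¬KFree2-*-dividing p-prime p∣d)

  μ-*-nondividing : ∀ {p d} → Prime p → 1 ≤ d → ¬ p ∣ d → μ (p * d) ≡ ℤ.- μ d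
  μ-*-nondividing {p} {d} p-prime d≥1 p∤d with kFree? {2} (s≤s z≤n) d
  ... | yes kfree = begin
    μ (p * d)                          ≡⟨ μ-squarefree (KFree2-*-nondividing p-prime p∤d kfree) ⟩
    (ℤ.- 1ℤ) ℤ.^ ω (p * d)             ≡⟨ cong ((ℤ.- 1ℤ) ℤ.^_) (ω-* p-prime d≥1 p∤d) ⟩
    (ℤ.- 1ℤ) ℤ.* (ℤ.- 1ℤ) ℤ.^ ω d      ≡⟨ ℤ.-1*i≡-i _ ⟩
    ℤ.- ((ℤ.- 1ℤ) ℤ.^ ω d)             ≡⟨ cong ℤ.-_ (μ-squarefree kfree) ⟨
    ℤ.- μ d                            ∎
  ... | no ¬kfree = begin
    μ (p * d)  ≡⟨ μ-nonSquarefree (ℕ.*-mono-≤ (prime⇒≥1 p-prime) d≥1) (¬kfree ∘ KFree-*ʳ {2} p) ⟩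
    0ℤ         ≡⟨ cong ℤ.-_ (μ-nonSquarefree d≥1 ¬kfree) ⟨
    ℤ.- μ d    ∎

open Arithmetic

module FareyFractions {k} (k≥1 : 1 ≤ k) (m : ℕ) (b : ℤ) where

  congruent? : ∀ q → Dec ((+ q) ≡ b [mod m ])
  congruent? q = m ∣? ℤ.∣ + q ℤ.- b ∣

  Selected : ℕ → ℕ → Set
  Selected a q = Coprime a q × KFree k q × (+ q) ≡ b [mod m ]

  selected? : ∀ a q → Dec (Selected a q)
  selected? a q = coprime? a q ×-dec kFree? k≥1 q ×-dec congruent? q

  admissible : ℕ → ℤ
  admissible q = if does (congruent? q) then μk² k q else 0ℤ

  fareyRow : ℕ → List ℚ
  fareyRow q = concatUpTo q λ a → if does (selected? a q) then [ frac a q ] else []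

  fareyList : ℕ → List ℚ
  fareyList Q = concatUpTo Q fareyRow

  ∈-fareyRow⁻ : ∀ {q r} → r ∈ fareyRow q → ∃[ a ] (1 ≤ a × a ≤ q × Selected a q × r ≡ frac a q)
  ∈-fareyRow⁻ {q} r∈ with ∈-concatUpTo⁻ q _ r∈
  ... | a , 1≤a , a≤q , r∈[a/q] with ∈-if-[]⁻ (does (selected? a q)) r∈[a/q]
  ...   | sel , r≡a/q = a , 1≤a , a≤q , does≡true⇒ (selected? a q) sel , r≡a/q

  fareyRow-unique : ∀ q → Unique (fareyRow q)
  fareyRow-unique zero    = []
  fareyRow-unique (suc q) = concatUpTo-unique (suc q) _ (λ a → if-[]-unique _ _) same-numerator
    where
    same-numerator : ∀ {a a′ r} → r ∈ (if does (selected? a (suc q)) then [ frac a (suc q) ] else []) →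
                     r ∈ (if does (selected? a′ (suc q)) then [ frac a′ (suc q) ] else []) → a ≡ a′
    same-numerator {a} {a′} r∈ r∈′
      with ∈-if-[]⁻ (does (selected? a (suc q))) r∈ | ∈-if-[]⁻ (does (selected? a′ (suc q))) r∈′
    ... | sel , r≡ | sel′ , r≡′ = proj₁ (frac-injective (s≤s z≤n) (s≤s z≤n)
      (proj₁ (does≡true⇒ (selected? a _) sel)) (proj₁ (does≡true⇒ (selected? a′ _) sel′)) (trans (sym r≡) r≡′))

  fareyRow-disjoint : ∀ {q q′ r} → r ∈ fareyRow q → r ∈ fareyRow q′ → q ≡ q′
  fareyRow-disjoint {q} {q′} r∈ r∈′ with ∈-fareyRow⁻ {q} r∈ | ∈-fareyRow⁻ {q′} r∈′
  ... | _ , 1≤a , a≤q , (cop , _) , r≡ | _ , 1≤a′ , a′≤q′ , (cop′ , _) , r≡′ =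
    proj₂ (frac-injective (ℕ.≤-trans 1≤a a≤q) (ℕ.≤-trans 1≤a′ a′≤q′) cop cop′ (trans (sym r≡) r≡′))

  fareyList-unique : ∀ Q → Unique (fareyList Q)
  fareyList-unique Q = concatUpTo-unique Q fareyRow fareyRow-unique fareyRow-disjoint

  -- The description of γ in lemma2p5, verbatim.
  FareyMember : ℕ → ℚ → Set
  FareyMember Q r = Σ ℕ λ a → Σ ℕ λ q′ →
    1 ≤ a × a ≤ suc q′ × suc q′ ≤ Q × Coprime a (suc q′) × KFree k (suc q′)
    × (+ suc q′) ≡ b [mod m ] × r ≡ (+ a) / suc q′

  ∈-fareyList : ∀ Q {r} → r ∈ fareyList Q ⇔ FareyMember Q r
  ∈-fareyList Q = mk⇔ (in-some-row ∘ ∈-concatUpTo⁻ Q fareyRow) from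
    where
    -- Split q here rather than by `with`, which would normalise fareyRow (suc q′) and so run
    -- the primality tests of kFreeᵇ on a symbolic number.
    in-row : ∀ {q r} → 1 ≤ q → q ≤ Q → ∃[ a ] (1 ≤ a × a ≤ q × Selected a q × r ≡ frac a q) → FareyMember Q r
    in-row {suc q′} _ q≤Q (a , 1≤a , a≤q , (cop , kfree , congruent) , r≡) =
      a , q′ , 1≤a , a≤q , q≤Q , cop , kfree , congruent , r≡
    in-some-row : ∀ {r} → ∃[ q ] (1 ≤ q × q ≤ Q × r ∈ fareyRow q) → FareyMember Q r
    in-some-row (q , 1≤q , q≤Q , r∈row) = in-row 1≤q q≤Q (∈-fareyRow⁻ r∈row)
    from : ∀ {r} → FareyMember Q r → r ∈ fareyList Q
    from (a , q′ , 1≤a , a≤q , q≤Q , cop , kfree , congruent , refl) =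
      ∈-concatUpTo⁺ Q fareyRow (s≤s z≤n) q≤Q (∈-concatUpTo⁺ (suc q′) _ 1≤a a≤q
        (∈-if-[]⁺ (dec-true (selected? a (suc q′)) (cop , kfree , congruent))))


module Sums {c ℓ : Level} (R : CommutativeRing c ℓ) where

  open CommutativeRing R renaming (refl to ≈-refl; sym to ≈-sym; trans to ≈-trans)
  open import Relation.Binary.Reasoning.Setoid setoid
  open import Algebra.Properties.Ring ring using (-‿distribˡ-*; -‿involutive; -‿+-comm; -0#≈0#)
  open import Algebra.Properties.CommutativeSemigroup +-commutativeSemigroup using (interchange; xy∙z≈xz∙y)
  open import Data.List.Relation.Binary.Permutation.Setoid.Properties setoid using (foldr-commMonoid)

  ιℕ-+ : ∀ m n → ιℕ R (m ℕ.+ n) ≈ ιℕ R m + ιℕ R n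
  ιℕ-+ zero    n = ≈-sym (+-identityˡ _)
  ιℕ-+ (suc m) n = ≈-trans (+-congʳ (ιℕ-+ m n)) (xy∙z≈xz∙y _ _ _)

  ι-⊖ : ∀ m n → ι R (m ⊖ n) ≈ ιℕ R m - ιℕ R n
  ι-⊖ m       zero    = begin
    ι R (m ⊖ 0)     ≡⟨ cong (ι R) (ℤ.⊖-≥ {m} {0} z≤n) ⟩
    ιℕ R m          ≈⟨ +-identityʳ _ ⟨
    ιℕ R m + 0#     ≈⟨ +-congˡ -0#≈0# ⟨
    ιℕ R m - 0#     ∎
  ι-⊖ zero    (suc n) = begin
    ι R (0 ⊖ suc n)  ≡⟨ cong (ι R) (ℤ.⊖-< {0} {suc n} (s≤s z≤n)) ⟩
    - ιℕ R (suc n)   ≈⟨ +-identityˡ _ ⟨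
    0# - ιℕ R (suc n) ∎
  ι-⊖ (suc m) (suc n) = begin
    ι R (suc m ⊖ suc n)                ≡⟨ cong (ι R) (ℤ.[1+m]⊖[1+n]≡m⊖n m n) ⟩
    ι R (m ⊖ n)                        ≈⟨ ι-⊖ m n ⟩
    ιℕ R m - ιℕ R n                    ≈⟨ +-identityʳ _ ⟨
    (ιℕ R m - ιℕ R n) + 0#             ≈⟨ +-congˡ (-‿inverseʳ 1#) ⟨
    (ιℕ R m - ιℕ R n) + (1# - 1#)      ≈⟨ interchange _ _ _ _ ⟩
    (ιℕ R m + 1#) + (- ιℕ R n - 1#)    ≈⟨ +-congˡ (-‿+-comm _ _) ⟩
    (ιℕ R m + 1#) - (ιℕ R n + 1#)      ∎

  ι-+ : ∀ x y → ι R (x ℤ.+ y) ≈ ι R x + ι R y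
  ι-+ (+ m)    (+ n)    = ιℕ-+ m n
  ι-+ (+ m)    -[1+ n ] = ι-⊖ m (suc n)
  ι-+ -[1+ m ] (+ n)    = ≈-trans (ι-⊖ n (suc m)) (+-comm _ _)
  ι-+ -[1+ m ] -[1+ n ] = begin
    - ιℕ R (suc (suc (m ℕ.+ n)))       ≡⟨ cong (λ k → - ιℕ R (suc k)) (ℕ.+-suc m n) ⟨
    - ιℕ R (suc m ℕ.+ suc n)           ≈⟨ -‿cong (ιℕ-+ (suc m) (suc n)) ⟩
    - (ιℕ R (suc m) + ιℕ R (suc n))    ≈⟨ -‿+-comm _ _ ⟨
    - ιℕ R (suc m) - ιℕ R (suc n)      ∎

  ι-neg : ∀ x → ι R (ℤ.- x) ≈ - ι R x
  ι-neg (+ zero)  = ≈-sym -0#≈0#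
  ι-neg (+ suc n) = ≈-refl
  ι-neg -[1+ n ]  = ≈-sym (-‿involutive _)

  ι-1 : ι R 1ℤ ≈ 1#
  ι-1 = +-identityˡ 1#

  ι-+* : ∀ m y → ι R (+ m ℤ.* y) ≈ ιℕ R m * ι R y
  ι-+* zero    y = ≈-sym (zeroˡ _)
  ι-+* (suc m) y = begin
    ι R (+ suc m ℤ.* y)                ≡⟨ cong (ι R) (ℤ.suc-* (+ m) y) ⟩
    ι R (y ℤ.+ + m ℤ.* y)              ≈⟨ ι-+ y (+ m ℤ.* y) ⟩
    ι R y + ι R (+ m ℤ.* y)            ≈⟨ +-congˡ (ι-+* m y) ⟩
    ι R y + ιℕ R m * ι R y             ≈⟨ +-cong (*-identityˡ _) ≈-refl ⟨
    1# * ι R y + ιℕ R m * ι R y        ≈⟨ distribʳ _ _ _ ⟨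
    (1# + ιℕ R m) * ι R y              ≈⟨ *-congʳ (+-comm _ _) ⟩
    (ιℕ R m + 1#) * ι R y              ∎

  ι-* : ∀ x y → ι R (x ℤ.* y) ≈ ι R x * ι R y
  ι-* (+ m)    y = ι-+* m y
  ι-* -[1+ m ] y = begin
    ι R (-[1+ m ] ℤ.* y)               ≡⟨ cong (ι R) (ℤ.neg-distribˡ-* (+ suc m) y) ⟨
    ι R (ℤ.- (+ suc m ℤ.* y))          ≈⟨ ι-neg (+ suc m ℤ.* y) ⟩
    - ι R (+ suc m ℤ.* y)              ≈⟨ -‿cong (ι-+* (suc m) y) ⟩
    - (ιℕ R (suc m) * ι R y)           ≈⟨ -‿distribˡ-* _ _ ⟩
    - ιℕ R (suc m) * ι R y             ∎

  ι-if-* : ∀ e x y → ι R (if e then x ℤ.* y else 0ℤ) ≈ ι R x * ι R (if e then y else 0ℤ)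
  ι-if-* true  x y = ι-* x y
  ι-if-* false x y = ≈-sym (zeroʳ _)

  ∑ : ℕ → (ℕ → Carrier) → Carrier
  ∑ zero    g = 0#
  ∑ (suc n) g = ∑ n g + g (suc n)

  sumR-as-∑ : ∀ n (g h : ℕ → Carrier) → (∀ i → i < n → g i ≈ h (suc i)) → sumR R n g ≈ ∑ n h
  sumR-as-∑ zero    g h g≈h = ≈-refl
  sumR-as-∑ (suc n) g h g≈h = +-cong (sumR-as-∑ n g h λ i i<n → g≈h i (ℕ.m<n⇒m<1+n i<n)) (g≈h n ℕ.≤-refl)

  ι-sumℤ : ∀ n h → ι R (sumℤ n h) ≈ ∑ n (ι R ∘ h)
  ι-sumℤ zero    h = ≈-refl
  ι-sumℤ (suc n) h = ≈-trans (ι-+ (sumℤ n h) (h (suc n))) (+-congʳ (ι-sumℤ n h))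

  ∑-cong : ∀ n {g h : ℕ → Carrier} → (∀ i → 1 ≤ i → i ≤ n → g i ≈ h i) → ∑ n g ≈ ∑ n h
  ∑-cong zero    g≈h = ≈-refl
  ∑-cong (suc n) g≈h =
    +-cong (∑-cong n λ i 1≤i i≤n → g≈h i 1≤i (ℕ.m≤n⇒m≤1+n i≤n)) (g≈h (suc n) (s≤s z≤n) ℕ.≤-refl)

  ∑-zero : ∀ n {g : ℕ → Carrier} → (∀ i → 1 ≤ i → i ≤ n → g i ≈ 0#) → ∑ n g ≈ 0#
  ∑-zero zero    g≈0 = ≈-refl
  ∑-zero (suc n) g≈0 = begin
    ∑ n _ + _   ≈⟨ +-cong (∑-zero n λ i 1≤i i≤n → g≈0 i 1≤i (ℕ.m≤n⇒m≤1+n i≤n)) (g≈0 (suc n) (s≤s z≤n) ℕ.≤-refl) ⟩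
    0# + 0#     ≈⟨ +-identityʳ 0# ⟩
    0#          ∎

  ∑-+ : ∀ n (g h : ℕ → Carrier) → ∑ n (λ i → g i + h i) ≈ ∑ n g + ∑ n h
  ∑-+ zero    g h = ≈-sym (+-identityˡ 0#)
  ∑-+ (suc n) g h = ≈-trans (+-congʳ (∑-+ n g h)) (interchange _ _ _ _)

  ∑-*ˡ : ∀ n x (g : ℕ → Carrier) → ∑ n (λ i → x * g i) ≈ x * ∑ n g
  ∑-*ˡ zero    x g = ≈-sym (zeroʳ x)
  ∑-*ˡ (suc n) x g = ≈-trans (+-congʳ (∑-*ˡ n x g)) (≈-sym (distribˡ x _ _))

  ∑-*ʳ : ∀ n x (g : ℕ → Carrier) → ∑ n (λ i → g i * x) ≈ ∑ n g * x
  ∑-*ʳ n x g = begin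
    ∑ n (λ i → g i * x)  ≈⟨ ∑-cong n (λ i _ _ → *-comm (g i) x) ⟩
    ∑ n (λ i → x * g i)  ≈⟨ ∑-*ˡ n x g ⟩
    x * ∑ n g            ≈⟨ *-comm x _ ⟩
    ∑ n g * x            ∎

  ∑-swap : ∀ n m (g : ℕ → ℕ → Carrier) → ∑ n (λ i → ∑ m (g i)) ≈ ∑ m (λ j → ∑ n (λ i → g i j))
  ∑-swap zero    m g = ≈-sym (∑-zero m λ _ _ _ → ≈-refl)
  ∑-swap (suc n) m g = ≈-trans (+-congʳ (∑-swap n m g)) (≈-sym (∑-+ m _ _))

  ∑-truncate : ∀ {l} n (g : ℕ → Carrier) → l ≤ n → (∀ i → l < i → g i ≈ 0#) → ∑ n g ≈ ∑ l g
  ∑-truncate n g l≤n g≈0 with ℕ.m≤n⇒m<n∨m≡n l≤n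
  ... | inj₂ refl = ≈-refl
  ∑-truncate (suc n) g l≤n g≈0 | inj₁ (s≤s l≤n′) = begin
    ∑ n g + g (suc n)   ≈⟨ +-cong (∑-truncate n g l≤n′ g≈0) (g≈0 (suc n) (s≤s l≤n′)) ⟩
    _ + 0#              ≈⟨ +-identityʳ _ ⟩
    _                   ∎

  when : Bool → Carrier → Carrier
  when b x = if b then x else 0#

  when-yes : ∀ {a} {A : Set a} (a? : Dec A) {x} → A → when (does a?) x ≈ x
  when-yes a? {x} a = reflexive (cong (λ b → when b x) (dec-true a? a))

  when-no : ∀ {a} {A : Set a} (a? : Dec A) {x} → ¬ A → when (does a?) x ≈ 0#
  when-no a? {x} ¬a = reflexive (cong (λ b → when b x) (dec-false a? ¬a))

  when-⇔ : ∀ {a b} {A : Set a} {B : Set b} (a? : Dec A) (b? : Dec B) {x} →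
           A ⇔ B → when (does a?) x ≈ when (does b?) x
  when-⇔ a? b? {x} A⇔B = reflexive (cong (λ b → when b x) (does-⇔ A⇔B a? b?))

  when-cong : ∀ b {x y} → x ≈ y → when b x ≈ when b y
  when-cong true  x≈y = x≈y
  when-cong false x≈y = ≈-refl

  when-∧ : ∀ b e x → when b (when e x) ≡ when (b ∧ e) x
  when-∧ true  e x = refl
  when-∧ false e x = refl

  when-comm : ∀ b e x → when b (when e x) ≡ when e (when b x)
  when-comm true  e     x = refl
  when-comm false true  x = refl
  when-comm false false x = refl

  when-split : ∀ b x → x ≈ when b x + when (not b) x
  when-split true  x = ≈-sym (+-identityʳ x)
  when-split false x = ≈-sym (+-identityˡ x)

  when-neg : ∀ b x → when b (- x) ≈ - when b x
  when-neg true  x = ≈-refl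
  when-neg false x = ≈-sym -0#≈0#

  when-*ʳ : ∀ b x y → when b x * y ≈ when b (x * y)
  when-*ʳ true  x y = ≈-refl
  when-*ʳ false x y = zeroˡ y

  when-∑ : ∀ b n (g : ℕ → Carrier) → when b (∑ n g) ≈ ∑ n (λ i → when b (g i))
  when-∑ true  n g = ≈-refl
  when-∑ false n g = ≈-sym (∑-zero n λ _ _ _ → ≈-refl)

  when-∧-indicator : ∀ c s e x → when (c ∧ (s ∧ e)) x ≈ when c (ι R (if e then (if s then 1ℤ else 0ℤ) else 0ℤ) * x)
  when-∧-indicator false s     e     x = ≈-refl
  when-∧-indicator true  true  true  x = ≈-sym (≈-trans (*-congʳ ι-1) (*-identityˡ x))
  when-∧-indicator true  true  false x = ≈-sym (zeroˡ x)
  when-∧-indicator true  false true  x = ≈-sym (zeroˡ x)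
  when-∧-indicator true  false false x = ≈-sym (zeroˡ x)

  sumList-↭ : ∀ {xs ys : List Carrier} → xs ↭ ys → sumList R xs ≈ sumList R ys
  sumList-↭ xs↭ys = foldr-commMonoid +-isCommutativeMonoid (↭⇒↭ₛ′ isEquivalence xs↭ys)

  sumList-++ : ∀ (xs ys : List Carrier) → sumList R (xs ++ ys) ≈ sumList R xs + sumList R ys
  sumList-++ []       ys = ≈-sym (+-identityˡ _)
  sumList-++ (x ∷ xs) ys = ≈-trans (+-congˡ (sumList-++ xs ys)) (≈-sym (+-assoc _ _ _))

  sumList-concatUpTo : ∀ {a} {A : Set a} n (L : ℕ → List A) (f : A → Carrier) →
    sumList R (map f (concatUpTo n L)) ≈ ∑ n (λ i → sumList R (map f (L i)))
  sumList-concatUpTo zero    L f = ≈-refl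
  sumList-concatUpTo (suc n) L f = begin
    sumList R (map f (concatUpTo n L ++ L (suc n)))
      ≡⟨ cong (sumList R) (map-++ f (concatUpTo n L) _) ⟩
    sumList R (map f (concatUpTo n L) ++ map f (L (suc n)))
      ≈⟨ sumList-++ (map f (concatUpTo n L)) _ ⟩
    sumList R (map f (concatUpTo n L)) + sumList R (map f (L (suc n)))
      ≈⟨ +-congʳ (sumList-concatUpTo n L f) ⟩
    ∑ (suc n) (λ i → sumList R (map f (L i)))
      ∎

  sumList-if-[] : ∀ {a} {A : Set a} b (x : A) (f : A → Carrier) →
                  sumList R (map f (if b then [ x ] else [])) ≈ when b (f x)
  sumList-if-[] true  x f = +-identityʳ (f x)
  sumList-if-[] false x f = ≈-refl

  ∑-when-≤ : ∀ {l} n (g : ℕ → Carrier) → l ≤ n → ∑ n (λ i → when (does (i ≤? l)) (g i)) ≈ ∑ l g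
  ∑-when-≤ {l} n g l≤n = begin
    ∑ n (λ i → when (does (i ≤? l)) (g i))  ≈⟨ ∑-truncate n _ l≤n (λ i l<i → when-no (i ≤? l) (ℕ.<⇒≱ l<i)) ⟩
    ∑ l (λ i → when (does (i ≤? l)) (g i))  ≈⟨ ∑-cong l (λ i _ i≤l → when-yes (i ≤? l) i≤l) ⟩
    ∑ l g                                    ∎

  ∑-δ : ∀ {p} n (g : ℕ → Carrier) → 1 ≤ p → p ≤ n → ∑ n (λ i → when (does (i ≟ p)) (g i)) ≈ g p
  ∑-δ zero    g 1≤p p≤0 = contradiction (ℕ.≤-trans 1≤p p≤0) λ ()
  ∑-δ {p} (suc n) g 1≤p p≤1+n with ℕ.m≤n⇒m<n∨m≡n p≤1+n
  ... | inj₁ (s≤s p≤n) = begin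
    ∑ n _ + when (does (suc n ≟ p)) (g (suc n))
      ≈⟨ +-cong (∑-δ n g 1≤p p≤n) (when-no (suc n ≟ p) (ℕ.>⇒≢ (s≤s p≤n))) ⟩
    g p + 0#   ≈⟨ +-identityʳ _ ⟩
    g p        ∎
  ... | inj₂ refl = begin
    ∑ n _ + when (does (suc n ≟ suc n)) (g (suc n))
      ≈⟨ +-cong (∑-zero n λ i _ i≤n → when-no (i ≟ suc n) (ℕ.<⇒≢ (s≤s i≤n))) (when-yes (suc n ≟ suc n) refl) ⟩
    0# + g (suc n)   ≈⟨ +-identityˡ _ ⟩
    g (suc n)        ∎

  ∑-multiples : ∀ {e} n (g : ℕ → Carrier) → 1 ≤ e →
    ∑ n (λ i → when (does (e ∣? i)) (g i)) ≈ ∑ n (λ j → when (does (e ℕ.* j ≤? n)) (g (e ℕ.* j)))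
  ∑-multiples {e} n g 1≤e = begin
    ∑ n (λ i → when (does (e ∣? i)) (g i))                     ≈⟨ ∑-cong n divisibility-as-δ ⟩
    ∑ n (λ i → ∑ n (λ j → when (does (i ≟ e ℕ.* j)) (g i)))    ≈⟨ ∑-swap n n _ ⟩
    ∑ n (λ j → ∑ n (λ i → when (does (i ≟ e ℕ.* j)) (g i)))    ≈⟨ ∑-cong n (λ j 1≤j _ → collapse j 1≤j) ⟩
    ∑ n (λ j → when (does (e ℕ.* j ≤? n)) (g (e ℕ.* j)))       ∎
    where
    instance _ = ℕ.>-nonZero 1≤e
    divisibility-as-δ : ∀ i → 1 ≤ i → i ≤ n →
                        when (does (e ∣? i)) (g i) ≈ ∑ n (λ j → when (does (i ≟ e ℕ.* j)) (g i))
    divisibility-as-δ i 1≤i i≤n with e ∣? i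
    ... | no e∤i = ≈-sym (∑-zero n λ j _ _ →
      when-no (i ≟ e ℕ.* j) λ i≡ej → e∤i (divides j (trans i≡ej (ℕ.*-comm e j))))
    ... | yes (divides k refl) = ≈-sym (begin
      ∑ n (λ j → when (does (k ℕ.* e ≟ e ℕ.* j)) (g (k ℕ.* e)))
        ≈⟨ ∑-cong n (λ j _ _ → when-⇔ (k ℕ.* e ≟ e ℕ.* j) (j ≟ k) (mk⇔
             (λ ke≡ej → ℕ.*-cancelˡ-≡ j k e (trans (sym ke≡ej) (ℕ.*-comm k e)))
             (λ j≡k → trans (ℕ.*-comm k e) (cong (e ℕ.*_) (sym j≡k))))) ⟩
      ∑ n (λ j → when (does (j ≟ k)) (g (k ℕ.* e)))   ≈⟨ ∑-δ n _ 1≤k (ℕ.≤-trans (ℕ.m≤m*n k e) i≤n) ⟩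
      g (k ℕ.* e)                                       ∎)
      where 1≤k = ℕ.n≢0⇒n>0 λ { refl → contradiction 1≤i λ () }
    collapse : ∀ j → 1 ≤ j → ∑ n (λ i → when (does (i ≟ e ℕ.* j)) (g i)) ≈ when (does (e ℕ.* j ≤? n)) (g (e ℕ.* j))
    collapse j 1≤j with e ℕ.* j ≤? n
    ... | yes ej≤n = ≈-trans (∑-δ n g (ℕ.*-mono-≤ 1≤e 1≤j) ej≤n) (≈-sym (when-yes (e ℕ.* j ≤? n) ej≤n))
    ... | no ej≰n  = ≈-trans (∑-zero n λ i _ i≤n → when-no (i ≟ e ℕ.* j) λ i≡ej → ej≰n (subst (_≤ n) i≡ej i≤n))
                             (≈-sym (when-no (e ℕ.* j ≤? n) ej≰n))

  ∑-multiples-exact : ∀ {e} n (g : ℕ → Carrier) → 1 ≤ e →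
    ∑ (e ℕ.* n) (λ i → when (does (e ∣? i)) (g i)) ≈ ∑ n (λ j → g (e ℕ.* j))
  ∑-multiples-exact {e} n g 1≤e = begin
    ∑ (e ℕ.* n) (λ i → when (does (e ∣? i)) (g i))
      ≈⟨ ∑-multiples (e ℕ.* n) g 1≤e ⟩
    ∑ (e ℕ.* n) (λ j → when (does (e ℕ.* j ≤? e ℕ.* n)) (g (e ℕ.* j)))
      ≈⟨ ∑-cong (e ℕ.* n) (λ j _ _ → when-⇔ (e ℕ.* j ≤? e ℕ.* n) (j ≤? n) (mk⇔ (ℕ.*-cancelˡ-≤ e) (ℕ.*-monoʳ-≤ e))) ⟩
    ∑ (e ℕ.* n) (λ j → when (does (j ≤? n)) (g (e ℕ.* j)))
      ≈⟨ ∑-when-≤ (e ℕ.* n) _ (ℕ.m≤n*m n e) ⟩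
    ∑ n (λ j → g (e ℕ.* j))  ∎
    where instance _ = ℕ.>-nonZero 1≤e

  ∑-when-*≤ : ∀ n q .{{_ : ℕ.NonZero q}} (g : ℕ → Carrier) →
    ∑ n (λ j → when (does (q ℕ.* j ≤? n)) (g j)) ≈ ∑ (n ℕ./ q) g
  ∑-when-*≤ n q g = ≈-trans (∑-cong n λ j _ _ → when-⇔ (q ℕ.* j ≤? n) (j ≤? n ℕ./ q) (mk⇔ to from))
                            (∑-when-≤ n g (m/n≤m n q))
    where
    to : ∀ {j} → q ℕ.* j ≤ n → j ≤ n ℕ./ q
    to {j} qj≤n = subst (_≤ n ℕ./ q) (m*n/n≡m j q) (/-monoˡ-≤ q (subst (_≤ n) (ℕ.*-comm q j) qj≤n))
    from : ∀ {j} → j ≤ n ℕ./ q → q ℕ.* j ≤ n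
    from {j} j≤n/q = ℕ.≤-trans (ℕ.≤-reflexive (ℕ.*-comm q j)) (ℕ.≤-trans (ℕ.*-monoˡ-≤ q j≤n/q) (m/n*n≤m n q))

  μR : ℕ → Carrier
  μR n = ι R (μ n)

  ∑-μ-divisors-of-1 : ∀ n → 1 ≤ n → ∑ n (λ d → when (does (d ∣? 1)) (μR d)) ≈ 1#
  ∑-μ-divisors-of-1 n 1≤n = begin
    ∑ n (λ d → when (does (d ∣? 1)) (μR d))
      ≈⟨ ∑-cong n (λ d _ _ → when-⇔ (d ∣? 1) (d ≟ 1) (mk⇔ ∣1⇒≡1 λ { refl → ∣-refl })) ⟩
    ∑ n (λ d → when (does (d ≟ 1)) (μR d))   ≈⟨ ∑-δ n μR ℕ.≤-refl 1≤n ⟩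
    ι R 1ℤ                                   ≈⟨ ι-1 ⟩
    1#                                       ∎

  -- For a prime p ∣ n the divisors p j of n cancel those prime to p, as μ (p j) is - μ j or 0.
  ∑-μ-divisors-vanish : ∀ {n} N → 2 ≤ n → n ≤ N → ∑ N (λ d → when (does (d ∣? n)) (μR d)) ≈ 0#
  ∑-μ-divisors-vanish {n} N 2≤n n≤N with ∃-prime-divisor n 2≤n
  ... | p , p-prime , divides m refl = begin
    ∑ N (λ d → when (does (d ∣? m ℕ.* p)) (μR d))
      ≈⟨ ∑-cong N (λ d _ _ → when-split (does (p ∣? d)) _) ⟩
    ∑ N (λ d → when (does (p ∣? d)) (when (does (d ∣? m ℕ.* p)) (μR d))
             + when (not (does (p ∣? d))) (when (does (d ∣? m ℕ.* p)) (μR d)))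
      ≈⟨ ∑-+ N _ _ ⟩
    ∑ N (λ d → when (does (p ∣? d)) (when (does (d ∣? m ℕ.* p)) (μR d)))
      + ∑ N (λ d → when (not (does (p ∣? d))) (when (does (d ∣? m ℕ.* p)) (μR d)))
      ≈⟨ +-cong (≈-trans (∑-multiples N _ (prime⇒≥1 p-prime)) (∑-cong N multiple-of-p))
                (∑-cong N λ d _ _ → not-multiple-of-p d) ⟩
    ∑ N (λ j → - Y j) + ∑ N Y       ≈⟨ ∑-+ N _ _ ⟨
    ∑ N (λ j → - Y j + Y j)        ≈⟨ ∑-zero N (λ j _ _ → -‿inverseˡ (Y j)) ⟩
    0#                             ∎
    where
    instance _ = prime⇒nonZero p-prime
    Y : ℕ → Carrier
    Y j = when (not (does (p ∣? j))) (when (does (j ∣? m)) (μR j))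
    μR-p* : ∀ j → 1 ≤ j → μR (p ℕ.* j) ≈ - when (not (does (p ∣? j))) (μR j)
    μR-p* j 1≤j with p ∣? j
    ... | yes p∣j = ≈-trans (reflexive (cong (ι R) (μ-*-dividing p-prime 1≤j p∣j))) (≈-sym -0#≈0#)
    ... | no  p∤j = ≈-trans (reflexive (cong (ι R) (μ-*-nondividing p-prime 1≤j p∤j))) (ι-neg (μ j))
    pj∣mp⇔j∣m : ∀ {j} → p ℕ.* j ∣ m ℕ.* p ⇔ j ∣ m
    pj∣mp⇔j∣m {j} = mk⇔ (λ pj∣mp → *-cancelˡ-∣ p (subst (p ℕ.* j ∣_) (ℕ.*-comm m p) pj∣mp))
                        (λ j∣m → subst (p ℕ.* j ∣_) (ℕ.*-comm p m) (*-monoʳ-∣ p j∣m))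
    multiple-of-p : ∀ j → 1 ≤ j → j ≤ N →
      when (does (p ℕ.* j ≤? N)) (when (does (p ℕ.* j ∣? m ℕ.* p)) (μR (p ℕ.* j))) ≈ - Y j
    multiple-of-p j 1≤j _ = begin
      when (does (p ℕ.* j ≤? N)) (when (does (p ℕ.* j ∣? m ℕ.* p)) (μR (p ℕ.* j)))
        ≡⟨ when-∧ (does (p ℕ.* j ≤? N)) _ _ ⟩
      when (does (p ℕ.* j ≤? N ×-dec p ℕ.* j ∣? m ℕ.* p)) (μR (p ℕ.* j))
        ≈⟨ when-⇔ (p ℕ.* j ≤? N ×-dec p ℕ.* j ∣? m ℕ.* p) (j ∣? m) (mk⇔
             (Equivalence.to pj∣mp⇔j∣m ∘ proj₂)
             (λ j∣m → let pj∣mp = Equivalence.from pj∣mp⇔j∣m j∣m in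
                      ℕ.≤-trans (∣⇒≤ ⦃ ℕ.>-nonZero (ℕ.≤-trans (s≤s z≤n) 2≤n) ⦄ pj∣mp) n≤N , pj∣mp)) ⟩
      when (does (j ∣? m)) (μR (p ℕ.* j))                          ≈⟨ when-cong (does (j ∣? m)) (μR-p* j 1≤j) ⟩
      when (does (j ∣? m)) (- when (not (does (p ∣? j))) (μR j))    ≈⟨ when-neg (does (j ∣? m)) _ ⟩
      - when (does (j ∣? m)) (when (not (does (p ∣? j))) (μR j))
        ≡⟨ cong -_ (when-comm (does (j ∣? m)) (not (does (p ∣? j))) (μR j)) ⟩
      - Y j                                                        ∎
    not-multiple-of-p : ∀ d → when (not (does (p ∣? d))) (when (does (d ∣? m ℕ.* p)) (μR d)) ≈ Y d
    not-multiple-of-p d with p ∣? d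
    ... | yes _   = ≈-refl
    ... | no  p∤d = when-⇔ (d ∣? m ℕ.* p) (d ∣? m)
      (mk⇔ (coprime-divisor (prime∤⇒coprime p-prime p∤d) ∘ subst (d ∣_) (ℕ.*-comm m p)) (∣m⇒∣m*n p))

  coprime-as-∑-μ : ∀ {a q} n x → 1 ≤ q → q ≤ n →
    when (does (coprime? a q)) x ≈ ∑ n (λ d → when (does (d ∣? q)) (when (does (d ∣? a)) (μR d * x)))
  coprime-as-∑-μ {a} {q} n x 1≤q q≤n = ≈-sym (begin
    ∑ n (λ d → when (does (d ∣? q)) (when (does (d ∣? a)) (μR d * x)))
      ≈⟨ ∑-cong n (λ d _ _ → common-divisor d) ⟩
    ∑ n (λ d → when (does (d ∣? gcd a q)) (μR d) * x)   ≈⟨ ∑-*ʳ n x _ ⟩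
    ∑ n (λ d → when (does (d ∣? gcd a q)) (μR d)) * x   ≈⟨ by-gcd (ℕ.m≤n⇒m<n∨m≡n 1≤gcd) ⟩
    when (does (coprime? a q)) x                        ∎)
    where
    1≤gcd : 1 ≤ gcd a q
    1≤gcd = ℕ.n≢0⇒n>0 (gcd[m,n]≢0 a q (inj₂ (ℕ.>⇒≢ 1≤q)))
    gcd≤n : gcd a q ≤ n
    gcd≤n = ℕ.≤-trans (gcd[m,n]≤n a q ⦃ ℕ.>-nonZero 1≤q ⦄) q≤n
    common-divisor : ∀ d → when (does (d ∣? q)) (when (does (d ∣? a)) (μR d * x))
                           ≈ when (does (d ∣? gcd a q)) (μR d) * x
    common-divisor d = begin
      when (does (d ∣? q)) (when (does (d ∣? a)) (μR d * x))  ≡⟨ when-∧ (does (d ∣? q)) _ _ ⟩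
      when (does (d ∣? q ×-dec d ∣? a)) (μR d * x)
        ≈⟨ when-⇔ (d ∣? q ×-dec d ∣? a) (d ∣? gcd a q) (mk⇔
             (λ (d∣q , d∣a) → gcd-greatest d∣a d∣q)
             (λ d∣g → ∣-trans d∣g (gcd[m,n]∣n a q) , ∣-trans d∣g (gcd[m,n]∣m a q))) ⟩
      when (does (d ∣? gcd a q)) (μR d * x)                  ≈⟨ when-*ʳ (does (d ∣? gcd a q)) _ _ ⟨
      when (does (d ∣? gcd a q)) (μR d) * x                  ∎
    by-gcd : 1 < gcd a q ⊎ 1 ≡ gcd a q →
             ∑ n (λ d → when (does (d ∣? gcd a q)) (μR d)) * x ≈ when (does (coprime? a q)) x
    by-gcd (inj₂ 1≡gcd) = begin
      ∑ n (λ d → when (does (d ∣? gcd a q)) (μR d)) * x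
        ≡⟨ cong (λ g → ∑ n (λ d → when (does (d ∣? g)) (μR d)) * x) 1≡gcd ⟨
      ∑ n (λ d → when (does (d ∣? 1)) (μR d)) * x        ≈⟨ *-congʳ (∑-μ-divisors-of-1 n (ℕ.≤-trans 1≤q q≤n)) ⟩
      1# * x                                             ≈⟨ *-identityˡ x ⟩
      x                                                  ≈⟨ when-yes (coprime? a q) (gcd≡1⇒coprime (sym 1≡gcd)) ⟨
      when (does (coprime? a q)) x                       ∎
    by-gcd (inj₁ 1<gcd) = begin
      ∑ n (λ d → when (does (d ∣? gcd a q)) (μR d)) * x  ≈⟨ *-congʳ (∑-μ-divisors-vanish n 1<gcd gcd≤n) ⟩
      0# * x                                             ≈⟨ zeroˡ x ⟩
      0#                                                 ≈⟨ when-no (coprime? a q) not-coprime ⟨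
      when (does (coprime? a q)) x                       ∎
      where not-coprime = ℕ.<⇒≢ 1<gcd ∘ sym ∘ coprime⇒gcd≡1

  ∑-coprime-möbius : (t : ℕ → Carrier) (F : ℕ → ℕ → Carrier) →
    (∀ d a q → 1 ≤ d → 1 ≤ q → F (d ℕ.* a) (d ℕ.* q) ≈ F a q) → ∀ Q →
    ∑ Q (λ q → ∑ q (λ a → when (does (coprime? a q)) (t q * F a q)))
    ≈ ∑ Q (λ q → ∑ Q (λ n → when (does (q ℕ.* n ≤? Q)) (μR n * t (q ℕ.* n))) * ∑ q (λ a → F a q))
  ∑-coprime-möbius t F F-scale Q = begin
    ∑ Q (λ q → ∑ q (λ a → when (does (coprime? a q)) (t q * F a q)))
      ≈⟨ ∑-cong Q (λ q 1≤q q≤Q → ∑-cong q λ a _ _ → coprime-as-∑-μ Q _ 1≤q q≤Q) ⟩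
    ∑ Q (λ q → ∑ q (λ a → ∑ Q (λ d → when (does (d ∣? q)) (when (does (d ∣? a)) (Z d q a)))))
      ≈⟨ ∑-cong Q (λ q _ _ → ∑-swap q Q _) ⟩
    ∑ Q (λ q → ∑ Q (λ d → ∑ q (λ a → when (does (d ∣? q)) (when (does (d ∣? a)) (Z d q a)))))
      ≈⟨ ∑-swap Q Q _ ⟩
    ∑ Q (λ d → ∑ Q (λ q → ∑ q (λ a → when (does (d ∣? q)) (when (does (d ∣? a)) (Z d q a)))))
      ≈⟨ ∑-cong Q (λ d 1≤d _ → substitute-multiples d 1≤d) ⟩
    ∑ Q (λ d → ∑ Q (λ q → when (does (d ℕ.* q ≤? Q)) (μR d * t (d ℕ.* q) * S q)))
      ≈⟨ ∑-swap Q Q _ ⟩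
    ∑ Q (λ q → ∑ Q (λ d → when (does (d ℕ.* q ≤? Q)) (μR d * t (d ℕ.* q) * S q)))
      ≈⟨ ∑-cong Q (λ q _ _ → ≈-trans (∑-cong Q λ d _ _ → factor-out q d) (∑-*ʳ Q (S q) _)) ⟩
    ∑ Q (λ q → ∑ Q (λ n → when (does (q ℕ.* n ≤? Q)) (μR n * t (q ℕ.* n))) * S q)
      ∎
    where
    S : ℕ → Carrier
    S q = ∑ q (λ a → F a q)
    Z : ℕ → ℕ → ℕ → Carrier
    Z d q a = μR d * (t q * F a q)
    substitute-multiples : ∀ d → 1 ≤ d →
      ∑ Q (λ q → ∑ q (λ a → when (does (d ∣? q)) (when (does (d ∣? a)) (Z d q a))))
      ≈ ∑ Q (λ q → when (does (d ℕ.* q ≤? Q)) (μR d * t (d ℕ.* q) * S q))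
    substitute-multiples d 1≤d = begin
      ∑ Q (λ q → ∑ q (λ a → when (does (d ∣? q)) (when (does (d ∣? a)) (Z d q a))))
        ≈⟨ ∑-cong Q (λ q _ _ → when-∑ (does (d ∣? q)) q _) ⟨
      ∑ Q (λ q → when (does (d ∣? q)) (∑ q (λ a → when (does (d ∣? a)) (Z d q a))))
        ≈⟨ ∑-multiples Q _ 1≤d ⟩
      ∑ Q (λ q → when (does (d ℕ.* q ≤? Q)) (∑ (d ℕ.* q) (λ a → when (does (d ∣? a)) (Z d (d ℕ.* q) a))))
        ≈⟨ ∑-cong Q (λ q 1≤q _ → when-cong (does (d ℕ.* q ≤? Q)) (inner q 1≤q)) ⟩
      ∑ Q (λ q → when (does (d ℕ.* q ≤? Q)) (μR d * t (d ℕ.* q) * S q))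
        ∎
      where
      inner : ∀ q → 1 ≤ q → ∑ (d ℕ.* q) (λ a → when (does (d ∣? a)) (Z d (d ℕ.* q) a)) ≈ μR d * t (d ℕ.* q) * S q
      inner q 1≤q = begin
        ∑ (d ℕ.* q) (λ a → when (does (d ∣? a)) (Z d (d ℕ.* q) a))  ≈⟨ ∑-multiples-exact q _ 1≤d ⟩
        ∑ q (λ a → μR d * (t (d ℕ.* q) * F (d ℕ.* a) (d ℕ.* q)))
          ≈⟨ ∑-cong q (λ a _ _ → ≈-trans (*-congˡ (*-congˡ (F-scale d a q 1≤d 1≤q))) (≈-sym (*-assoc _ _ _))) ⟩
        ∑ q (λ a → μR d * t (d ℕ.* q) * F a q)                         ≈⟨ ∑-*ˡ q _ _ ⟩
        μR d * t (d ℕ.* q) * S q                                       ∎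
    factor-out : ∀ q d → when (does (d ℕ.* q ≤? Q)) (μR d * t (d ℕ.* q) * S q)
                         ≈ when (does (q ℕ.* d ≤? Q)) (μR d * t (q ℕ.* d)) * S q
    factor-out q d = begin
      when (does (d ℕ.* q ≤? Q)) (μR d * t (d ℕ.* q) * S q)   ≈⟨ when-*ʳ (does (d ℕ.* q ≤? Q)) _ _ ⟨
      when (does (d ℕ.* q ≤? Q)) (μR d * t (d ℕ.* q)) * S q
        ≡⟨ cong (λ k → when (does (k ≤? Q)) (μR d * t k) * S q) (ℕ.*-comm d q) ⟩
      when (does (q ℕ.* d ≤? Q)) (μR d * t (q ℕ.* d)) * S q   ∎

module FareySums {c ℓ : Level} (R : CommutativeRing c ℓ) {k} (k≥1 : 1 ≤ k) (m : ℕ) (b : ℤ) where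

  open CommutativeRing R renaming (refl to ≈-refl; sym to ≈-sym; trans to ≈-trans)
  open import Relation.Binary.Reasoning.Setoid setoid
  open Sums R
  open FareyFractions k≥1 m b

  sumList-fareyList : ∀ Q (f : ℚ → Carrier) →
    sumList R (map f (fareyList Q)) ≈ ∑ Q (λ q → ∑ q (λ a → when (does (selected? a q)) (f (frac a q))))
  sumList-fareyList Q f = ≈-trans (sumList-concatUpTo Q fareyRow f) (∑-cong Q λ q _ _ →
    ≈-trans (sumList-concatUpTo q _ f) (∑-cong q λ a _ _ → sumList-if-[] (does (selected? a q)) _ f))

  -- For q ≥ 1, μk² k q and does (kFree? k≥1 q) both reduce to kFreeᵇ k q.
  ∑-selected-as-coprime : ∀ Q (F : ℕ → ℕ → Carrier) →
    ∑ Q (λ q → ∑ q (λ a → when (does (selected? a q)) (F a q)))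
    ≈ ∑ Q (λ q → ∑ q (λ a → when (does (coprime? a q)) (ι R (admissible q) * F a q)))
  ∑-selected-as-coprime Q F = ∑-cong Q λ { (suc q′) _ _ → ∑-cong (suc q′) λ a _ _ →
    when-∧-indicator (does (coprime? a (suc q′))) (does (kFree? k≥1 (suc q′))) (does (congruent? (suc q′))) _ }

  ι-M : ∀ Q q′ → ι R (M k m b Q q′)
                ≈ ∑ Q (λ n → when (does (suc q′ ℕ.* n ≤? Q)) (μR n * ι R (admissible (suc q′ ℕ.* n))))
  ι-M Q q′ = begin
    ι R (M k m b Q q′)   ≈⟨ ι-sumℤ (Q ℕ./ suc q′) _ ⟩
    ∑ (Q ℕ./ suc q′) _   ≈⟨ ∑-cong (Q ℕ./ suc q′) (λ n _ _ → ι-if-* (does (congruent? (suc q′ ℕ.* n))) (μ n) _) ⟩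
    ∑ (Q ℕ./ suc q′) (λ n → μR n * ι R (admissible (suc q′ ℕ.* n)))  ≈⟨ ∑-when-*≤ Q (suc q′) _ ⟨
    ∑ Q (λ n → when (does (suc q′ ℕ.* n ≤? Q)) (μR n * ι R (admissible (suc q′ ℕ.* n))))  ∎

lemma2p5 : {c ℓ : Level} (R : CommutativeRing c ℓ) →
  (k m : ℕ) (b : ℤ) (Q : ℕ) → 2 ≤ k → 1 ≤ m → ℤG.gcd b (+ m) ≡ 1ℤ → 1 ≤ Q →
  (f : ℚ → CommutativeRing.Carrier R) →
  (γ : List ℚ) → Unique γ →
  (∀ r → r ∈ γ ⇔ Σ ℕ (λ a → Σ ℕ (λ q' →
      1 ≤ a × a ≤ suc q' × suc q' ≤ Q × Coprime a (suc q') × KFree k (suc q')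
      × (+ suc q') ≡ b [mod m ] × r ≡ (+ a) / suc q'))) →
  CommutativeRing._≈_ R
    (sumList R (map f γ))
    (sumR R Q (λ q' → CommutativeRing._*_ R
      (ι R (M k m b Q q'))
      (sumR R (suc q') (λ a' → f ((+ suc a') / suc q')))))
lemma2p5 R k m b Q 2≤k _ _ _ f γ γ-unique γ-spec = begin
  sumList R (map f γ)
    ≈⟨ sumList-↭ (map⁺ f (unique-↭ γ-unique (fareyList-unique Q) (⇔-sym (∈-fareyList Q) ⇔-∘ γ-spec _))) ⟩
  sumList R (map f (fareyList Q))
    ≈⟨ sumList-fareyList Q f ⟩
  ∑ Q (λ q → ∑ q (λ a → when (does (selected? a q)) (F a q)))
    ≈⟨ ∑-selected-as-coprime Q F ⟩
  ∑ Q (λ q → ∑ q (λ a → when (does (coprime? a q)) (ι R (admissible q) * F a q)))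
    ≈⟨ ∑-coprime-möbius (ι R ∘ admissible) F (λ d a q 1≤d 1≤q → reflexive (cong f (frac-*-cancel d a q 1≤d 1≤q)))
                        Q ⟩
  ∑ Q (λ q → ∑ Q (λ n → when (does (q ℕ.* n ≤? Q)) (μR n * ι R (admissible (q ℕ.* n)))) * ∑ q (λ a → F a q))
    ≈⟨ sumR-as-∑ Q _ _ (λ q′ _ → *-cong (ι-M Q q′) (sumR-as-∑ (suc q′) _ _ λ _ _ → ≈-refl)) ⟨
  sumR R Q (λ q′ → ι R (M k m b Q q′) * sumR R (suc q′) (λ a′ → f ((+ suc a′) / suc q′)))
    ∎
  where
  k≥1 = ℕ.≤-trans (s≤s z≤n) 2≤k
  open CommutativeRing R renaming (refl to ≈-refl)
  open import Relation.Binary.Reasoning.Setoid setoid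
  open Sums R
  open FareyFractions k≥1 m b
  open FareySums R k≥1 m b
  F : ℕ → ℕ → Carrier
  F a q = f (frac a q)
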